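{- The pairs $(1,3)$, $(2,2)$, $(2,5)$, $(2,6)$, $(3,3)$, $(3,4)$, $(3,8)$, $(3,9)$ are not regular, and $dor(1,3) \leq 3$, $dor(2,2) \leq 5$, $dor(2,5) \leq 3$, $dor(2,6) \leq 3$, $dor(3,3) \leq 5$, $dor(3,4) \leq 5$, $dor(3,8) \leq 3$, and $dor(3,9) \leq 3$.
   Context: $\mathbf{N}=\{1,2,3,\dots\}$ and $[1,n]=\{1,2,\dots,n\}$. For integers $1 \leq a \leq b$, an $(a,b)$-triple is a set of the form $\{x,ax+d,bx+2d\}$ with $x,d \in \mathbf{N}$. $N(a,b;r)$ is the least positive integer, if it exists, such that every $r$-coloring of $[1,N(a,b;r)]$ contains a monochromatic $(a,b)$-triple. The pair $(a,b)$ is regular if $N(a,b;r)$ exists for all positive integers $r$; if not regular, its degree of regularity $dor(a,b)$ is the largest $r$ such that $N(a,b;r)$ exists. -}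

module Defs where

open import Data.Nat using (ℕ; _+_; _*_; _≤_; _<_; _>_)
open import Data.Fin using (Fin)
open import Data.Product using (Σ; _×_; ∃-syntax)
open import Relation.Binary.PropositionalEquality using (_≡_)
open import Relation.Nullary using (¬_)

-- An r-coloring of [1,n]; only its values on 1..n matter.
Coloring : ℕ → Set
Coloring r = ℕ → Fin r

-- All elements are ≥ 1 automatically, and since
-- 1 ≤ a ≤ b, the largest element is bx+2d, but we require all three ≤ n explicitly.
MonoTriple : (a b n : ℕ) {r : ℕ} → Coloring r → Set
MonoTriple a b n χ =
  ∃[ x ] ∃[ d ] (1 ≤ x × 1 ≤ d × x ≤ n × a * x + d ≤ n × b * x + 2 * d ≤ n
                 × χ x ≡ χ (a * x + d) × χ x ≡ χ (b * x + 2 * d))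

NExists : (a b r : ℕ) → Set
NExists a b r = ∃[ n ] ((χ : Coloring r) → MonoTriple a b n χ)

Regular : (a b : ℕ) → Set
Regular a b = (r : ℕ) → 1 ≤ r → NExists a b r

-- dor(a,b) ≤ k : N(a,b;r) exists for no r > k (the largest r for which it exists is at most k).
DorAtMost : (a b k : ℕ) → Set
DorAtMost a b k = (r : ℕ) → r > k → ¬ NExists a b r

NotRegularDorAtMost : (a b k : ℕ) → Set
NotRegularDorAtMost a b k = ¬ Regular a b × DorAtMost a b k

-- Fix a ratio p/q > 1 and colour n by ⌊log_{p/q} n⌋ mod m.  If p/q ≤ v/u ≤ (p/q)^(m-1), the
-- logarithms of u and v differ by one of 1, …, m-1, so u and v get different colours.  For each
-- pair (a,b) of the theorem, two elements of every (a,b)-triple are related in this way: for the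
-- ratio 2 with m = 3, 4/3 with m = 5, or 3/2 with m = 6 (for (2,2) and (3,3) which two depends
-- on the size of d relative to x).  So every interval has an m-colouring without monochromatic
-- (a,b)-triples, and N(a,b;r) does not exist for r ≥ m.
module Submission where

open import Data.Fin using (fromℕ<; toℕ)
open import Data.Fin.Properties using (toℕ-fromℕ<)
open import Data.List using (_∷_; [])
open import Data.Nat
open import Data.Nat.DivMod using (_%_; _/_; m≡m%n+[m/n]*n; m%n<n)
open import Data.Nat.Divisibility using (_∣_; ∣m+n∣m⇒∣n; n∣m*n; ∣⇒≤)
open import Data.Nat.Properties
open import Algebra.Properties.CommutativeSemigroup *-commutativeSemigroup
  using (x∙yz≈y∙xz; xy∙z≈y∙xz)
open import Data.Nat.Tactic.RingSolver using (solve)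
open import Data.Product using (_×_; _,_)
open import Data.Sum using (_⊎_; inj₁; inj₂)
open import Relation.Binary.PropositionalEquality
open import Relation.Nullary using (¬_; Dec; yes; no; contradiction)
open import Defs

m+k≡n⇒m≤n : ∀ {m n} k → m + k ≡ n → m ≤ n
m+k≡n⇒m≤n k refl = m≤m+n _ k

[m+o]%n≢m%n : ∀ m o n .{{_ : NonZero n}} → 0 < o → o < n → (m + o) % n ≢ m % n
[m+o]%n≢m%n m o n 0<o o<n eq = <⇒≱ o<n (∣⇒≤ {{>-nonZero 0<o}} n∣o)
  where
  open ≡-Reasoning
  quotients : m / n * n + o ≡ (m + o) / n * n
  quotients = +-cancelˡ-≡ (m % n) _ _ (begin
    m % n + (m / n * n + o)         ≡⟨ +-assoc (m % n) _ o ⟨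
    m % n + m / n * n + o           ≡⟨ cong (_+ o) (m≡m%n+[m/n]*n m n) ⟨
    m + o                           ≡⟨ m≡m%n+[m/n]*n (m + o) n ⟩
    (m + o) % n + (m + o) / n * n   ≡⟨ cong (_+ (m + o) / n * n) eq ⟩
    m % n + (m + o) / n * n         ∎)
  n∣o : n ∣ o
  n∣o = ∣m+n∣m⇒∣n (subst (n ∣_) (sym quotients) (n∣m*n ((m + o) / n))) (n∣m*n (m / n))

dorAtMost⇒¬regular : ∀ {a b} k → DorAtMost a b k → ¬ Regular a b
dorAtMost⇒¬regular k dor regular = dor (suc k) ≤-refl (regular (suc k) (s≤s z≤n))

module Level (p q : ℕ) .{{_ : NonZero q}} (q<p : q < p) where

  instance
    p≢0 : NonZero p
    p≢0 = >-nonZero (≤-<-trans z≤n q<p)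

  -- Reaches k n means (p/q)^k ≤ n; level F n is ⌊log_{p/q} n⌋, capped at F.
  Reaches : ℕ → ℕ → Set
  Reaches k n = p ^ k ≤ q ^ k * n

  reaches? : ∀ k n → Dec (Reaches k n)
  reaches? k n = p ^ k ≤? q ^ k * n

  level : ℕ → ℕ → ℕ
  level zero    n = zero
  level (suc F) n with reaches? (suc F) n
  ... | yes _ = suc F
  ... | no  _ = level F n

  level-≤ : ∀ F n → level F n ≤ F
  level-≤ zero    n = z≤n
  level-≤ (suc F) n with reaches? (suc F) n
  ... | yes _ = ≤-refl
  ... | no  _ = m≤n⇒m≤1+n (level-≤ F n)

  level-reaches : ∀ F {n} → 1 ≤ n → Reaches (level F n) n
  level-reaches zero    {n} 1≤n = ≤-trans 1≤n (m≤m+n n 0)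
  level-reaches (suc F) {n} 1≤n with reaches? (suc F) n
  ... | yes reach = reach
  ... | no  _ = level-reaches F 1≤n

  level-maximal : ∀ F {k n} → k ≤ F → Reaches k n → k ≤ level F n
  level-maximal zero    z≤n _ = z≤n
  level-maximal (suc F) {k} {n} k≤1+F reach with reaches? (suc F) n
  ... | yes _ = k≤1+F
  ... | no ¬reach with m≤n⇒m<n∨m≡n k≤1+F
  ...   | inj₁ k<1+F = level-maximal F (s≤s⁻¹ k<1+F) reach
  ...   | inj₂ refl  = contradiction reach ¬reach

  reaches-antitone : ∀ {k k′ n} → k ≤ k′ → Reaches k′ n → Reaches k n
  reaches-antitone {k} {n = n} k≤k′ reach with m≤n⇒∃[o]m+o≡n k≤k′
  ... | e , refl = *-cancelˡ-≤ (q ^ e) {{m^n≢0 q e}} (begin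
    q ^ e * p ^ k        ≤⟨ *-monoˡ-≤ (p ^ k) (^-monoˡ-≤ e (<⇒≤ q<p)) ⟩
    p ^ e * p ^ k        ≡⟨ *-comm (p ^ e) (p ^ k) ⟩
    p ^ k * p ^ e        ≡⟨ ^-distribˡ-+-* p k e ⟨
    p ^ (k + e)          ≤⟨ reach ⟩
    q ^ (k + e) * n      ≡⟨ cong (_* n) (^-distribˡ-+-* q k e) ⟩
    q ^ k * q ^ e * n    ≡⟨ xy∙z≈y∙xz (q ^ k) (q ^ e) n ⟩
    q ^ e * (q ^ k * n)  ∎)
    where open ≤-Reasoning

  reaches-suc : ∀ k {u v} → Reaches k u → p * u ≤ q * v → Reaches (suc k) v
  reaches-suc k {u} {v} reach pu≤qv = begin
    p * p ^ k            ≤⟨ *-monoʳ-≤ p reach ⟩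
    p * (q ^ k * u)      ≡⟨ x∙yz≈y∙xz p (q ^ k) u ⟩
    q ^ k * (p * u)      ≤⟨ *-monoʳ-≤ (q ^ k) pu≤qv ⟩
    q ^ k * (q * v)      ≡⟨ x∙yz≈y∙xz (q ^ k) q v ⟩
    q * (q ^ k * v)      ≡⟨ *-assoc q (q ^ k) v ⟨
    q * q ^ k * v        ∎
    where open ≤-Reasoning

  reaches-divide : ∀ i {t u v} → Reaches (i + t) v → q ^ i * v ≤ p ^ i * u → Reaches t u
  reaches-divide i {t} {u} {v} reach qv≤pu = *-cancelˡ-≤ (p ^ i) {{m^n≢0 p i}} (begin
    p ^ i * p ^ t        ≡⟨ ^-distribˡ-+-* p i t ⟨
    p ^ (i + t)          ≤⟨ reach ⟩
    q ^ (i + t) * v      ≡⟨ cong (_* v) (^-distribˡ-+-* q i t) ⟩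
    q ^ i * q ^ t * v    ≡⟨ xy∙z≈y∙xz (q ^ i) (q ^ t) v ⟩
    q ^ t * (q ^ i * v)  ≤⟨ *-monoʳ-≤ (q ^ t) qv≤pu ⟩
    q ^ t * (p ^ i * u)  ≡⟨ x∙yz≈y∙xz (q ^ t) (p ^ i) u ⟩
    p ^ i * (q ^ t * u)  ∎)
    where open ≤-Reasoning

  level-< : ∀ F {u v} → 1 ≤ u → ¬ Reaches F v → p * u ≤ q * v → level F u < level F v
  level-< F {u} {v} 1≤u ¬reach pu≤qv =
    level-maximal F (≮⇒≥ λ F<1+l → ¬reach (reaches-antitone (<⇒≤ F<1+l) next)) next
    where
    next : Reaches (suc (level F u)) v
    next = reaches-suc (level F u) (level-reaches F 1≤u) pu≤qv

  level-≤-+ : ∀ F i {u v} → 1 ≤ v → q ^ i * v ≤ p ^ i * u → level F v ≤ level F u + i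
  level-≤-+ F i {u} {v} 1≤v qv≤pu with ≤-total (level F v) i
  ... | inj₁ l≤i = ≤-trans l≤i (m≤n+m i (level F u))
  ... | inj₂ i≤l = begin
    level F v              ≡⟨ m+[n∸m]≡n i≤l ⟨
    i + (level F v ∸ i)    ≤⟨ +-monoʳ-≤ i (level-maximal F t≤F (reaches-divide i reach qv≤pu)) ⟩
    i + level F u          ≡⟨ +-comm i (level F u) ⟩
    level F u + i          ∎
    where
    open ≤-Reasoning
    reach : Reaches (i + (level F v ∸ i)) v
    reach = subst (λ k → Reaches k v) (sym (m+[n∸m]≡n i≤l)) (level-reaches F 1≤v)
    t≤F : level F v ∸ i ≤ F
    t≤F = ≤-trans (m∸n≤m (level F v) i) (level-≤ F v)

  -- Bernoulli's inequality (p/q)^k ≥ 1 + k/q, multiplied out.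
  bernoulli-step : ∀ k Q P → Q * (q + k) ≤ q * P → q * Q * (q + suc k) ≤ q * (p * P)
  bernoulli-step k Q P IH = begin
    q * Q * (q + suc k)        ≡⟨ solve (q ∷ k ∷ Q ∷ []) ⟩
    Q * (q * (q + k) + q)      ≤⟨ *-monoʳ-≤ Q (+-monoʳ-≤ (q * (q + k)) (m≤m+n q k)) ⟩
    Q * (q * (q + k) + (q + k)) ≡⟨ solve (q ∷ k ∷ Q ∷ []) ⟩
    Q * (q + k) * suc q        ≤⟨ *-mono-≤ IH q<p ⟩
    q * P * p                  ≡⟨ solve (q ∷ p ∷ P ∷ []) ⟩
    q * (p * P)                ∎
    where open ≤-Reasoning

  bernoulli : ∀ k → q ^ k * (q + k) ≤ q * p ^ k
  bernoulli zero    = ≤-reflexive (solve (q ∷ []))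
  bernoulli (suc k) = bernoulli-step k (q ^ k) (p ^ k) (bernoulli k)

  unreachable : ∀ N {z} → z ≤ N → ¬ Reaches (q * N) z
  unreachable N {z} z≤N reach = 1+n≰n (*-cancelˡ-≤ (q * Q) {{m*n≢0 q Q}} (begin
    q * Q * suc N      ≡⟨ expand Q ⟨
    Q * (q + F)        ≤⟨ bernoulli F ⟩
    q * p ^ F          ≤⟨ *-monoʳ-≤ q (≤-trans reach (*-monoʳ-≤ Q z≤N)) ⟩
    q * (Q * N)        ≡⟨ *-assoc q Q N ⟨
    q * Q * N          ∎))
    where
    open ≤-Reasoning
    F Q : ℕ
    F = q * N
    Q = q ^ F
    instance
      Q≢0 : NonZero Q
      Q≢0 = m^n≢0 q F
    expand : ∀ Q → Q * (q + q * N) ≡ q * Q * suc N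
    expand Q = solve (Q ∷ q ∷ N ∷ [])

  record Separated (hi u v : ℕ) : Set where
    constructor separated
    field
      lower : p * u ≤ q * v
      upper : q ^ hi * v ≤ p ^ hi * u

  separated-levels-differ : ∀ F hi {u v} → 1 ≤ u → ¬ Reaches F v → Separated hi u v →
                            level F u % suc hi ≢ level F v % suc hi
  separated-levels-differ F hi {u} {v} 1≤u ¬reach (separated pu≤qv qv≤pu) eq =
    [m+o]%n≢m%n lu t (suc hi) (m<n⇒0<n∸m lu<lv) (s≤s t≤hi)
      (trans (cong (_% suc hi) (m+[n∸m]≡n (<⇒≤ lu<lv))) (sym eq))
    where
    lu lv t : ℕ
    lu = level F u
    lv = level F v
    t = lv ∸ lu
    1≤v : 1 ≤ v
    1≤v = *-cancelˡ-≤ q (begin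
      q * 1   ≡⟨ *-identityʳ q ⟩
      q       ≤⟨ <⇒≤ q<p ⟩
      p       ≡⟨ *-identityʳ p ⟨
      p * 1   ≤⟨ *-monoʳ-≤ p 1≤u ⟩
      p * u   ≤⟨ pu≤qv ⟩
      q * v   ∎)
      where open ≤-Reasoning
    lu<lv : lu < lv
    lu<lv = level-< F 1≤u ¬reach pu≤qv
    t≤hi : t ≤ hi
    t≤hi = m≤n+o⇒m∸n≤o lv lu (level-≤-+ F hi 1≤v qv≤pu)

  colouring : ∀ {r} hi → hi < r → ℕ → Coloring r
  colouring hi hi<r F n = fromℕ< (≤-trans (m%n<n (level F n) (suc hi)) hi<r)

  separated-colours-differ : ∀ {r} hi (hi<r : hi < r) F {u v} → 1 ≤ u → ¬ Reaches F v →
                             Separated hi u v → colouring hi hi<r F u ≢ colouring hi hi<r F v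
  separated-colours-differ hi hi<r F 1≤u ¬reach sep eq = separated-levels-differ F hi 1≤u ¬reach sep
    (trans (sym (toℕ-fromℕ< _)) (trans (cong toℕ eq) (toℕ-fromℕ< _)))

  dorAtMost : ∀ a b hi k → hi ≤ k →
              (∀ x d → Separated hi x (a * x + d) ⊎ Separated hi (a * x + d) (b * x + 2 * d)) →
              DorAtMost a b k
  dorAtMost a b hi k hi≤k spread r k<r (N , mono) = no-monochromatic (mono χ)
    where
    hi<r : hi < r
    hi<r = ≤-<-trans hi≤k k<r
    χ : Coloring r
    χ = colouring hi hi<r (q * N)
    no-monochromatic : ¬ MonoTriple a b N χ
    no-monochromatic (x , d , 1≤x , 1≤d , _ , y≤N , z≤N , χx≡χy , χx≡χz) with spread x d
    ... | inj₁ sep = separated-colours-differ hi hi<r (q * N) 1≤x (unreachable N y≤N) sep χx≡χy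
    ... | inj₂ sep = separated-colours-differ hi hi<r (q * N) 1≤y (unreachable N z≤N) sep
                       (trans (sym χx≡χy) χx≡χz)
      where
      1≤y : 1 ≤ a * x + d
      1≤y = ≤-trans 1≤d (m≤n+m d (a * x))

module Ratio2 = Level 2 1 ≤-refl
module Ratio4/3 = Level 4 3 ≤-refl
module Ratio3/2 = Level 3 2 ≤-refl

dor13 : DorAtMost 1 3 3
dor13 = Ratio2.dorAtMost 1 3 2 3 (n≤1+n 2) λ x d → inj₂ (Ratio2.separated
  (m+k≡n⇒m≤n x (solve (x ∷ d ∷ []))) (m+k≡n⇒m≤n (x + 2 * d) (solve (x ∷ d ∷ []))))

dor25 : DorAtMost 2 5 3
dor25 = Ratio2.dorAtMost 2 5 2 3 (n≤1+n 2) λ x d → inj₂ (Ratio2.separated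
  (m+k≡n⇒m≤n x (solve (x ∷ d ∷ []))) (m+k≡n⇒m≤n (3 * x + 2 * d) (solve (x ∷ d ∷ []))))

dor26 : DorAtMost 2 6 3
dor26 = Ratio2.dorAtMost 2 6 2 3 (n≤1+n 2) λ x d → inj₂ (Ratio2.separated
  (m+k≡n⇒m≤n (2 * x) (solve (x ∷ d ∷ []))) (m+k≡n⇒m≤n (2 * x + 2 * d) (solve (x ∷ d ∷ []))))

dor38 : DorAtMost 3 8 3
dor38 = Ratio2.dorAtMost 3 8 2 3 (n≤1+n 2) λ x d → inj₂ (Ratio2.separated
  (m+k≡n⇒m≤n (2 * x) (solve (x ∷ d ∷ []))) (m+k≡n⇒m≤n (4 * x + 2 * d) (solve (x ∷ d ∷ []))))

dor39 : DorAtMost 3 9 3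
dor39 = Ratio2.dorAtMost 3 9 2 3 (n≤1+n 2) λ x d → inj₂ (Ratio2.separated
  (m+k≡n⇒m≤n (3 * x) (solve (x ∷ d ∷ []))) (m+k≡n⇒m≤n (3 * x + 2 * d) (solve (x ∷ d ∷ []))))

dor34 : DorAtMost 3 4 5
dor34 = Ratio4/3.dorAtMost 3 4 4 5 (n≤1+n 4) λ x d → inj₂ (Ratio4/3.separated
  (m+k≡n⇒m≤n (2 * d) (solve (x ∷ d ∷ []))) (m+k≡n⇒m≤n (444 * x + 94 * d) (solve (x ∷ d ∷ []))))

dor22 : DorAtMost 2 2 5
dor22 = Ratio4/3.dorAtMost 2 2 4 5 (n≤1+n 4) spread
  where
  open Ratio4/3 using (Separated; separated)
  spread : ∀ x d → Separated 4 x (2 * x + d) ⊎ Separated 4 (2 * x + d) (2 * x + 2 * d)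
  spread x d with ≤-total d x
  ... | inj₁ d≤x with m≤n⇒∃[o]m+o≡n d≤x
  ...   | e , refl = inj₁ (separated (m+k≡n⇒m≤n (2 * (d + e) + 3 * d) (solve (d ∷ e ∷ [])))
                                     (m+k≡n⇒m≤n (13 * d + 94 * e) (solve (d ∷ e ∷ []))))
  spread x d | inj₂ x≤d with m≤n⇒∃[o]m+o≡n x≤d
  ...   | e , refl = inj₂ (separated (m+k≡n⇒m≤n (2 * e) (solve (x ∷ e ∷ [])))
                                     (m+k≡n⇒m≤n (444 * x + 94 * e) (solve (x ∷ e ∷ []))))

dor33 : DorAtMost 3 3 5
dor33 = Ratio3/2.dorAtMost 3 3 5 5 ≤-refl spread
  where
  open Ratio3/2 using (Separated; separated)
  spread : ∀ x d → Separated 5 x (3 * x + d) ⊎ Separated 5 (3 * x + d) (3 * x + 2 * d)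
  spread x d with ≤-total d (3 * x)
  ... | inj₁ d≤3x = inj₁ (separated (m+k≡n⇒m≤n (3 * x + 2 * d) (solve (x ∷ d ∷ []))) (begin
    32 * (3 * x + d)        ≤⟨ *-monoʳ-≤ 32 (+-monoʳ-≤ (3 * x) d≤3x) ⟩
    32 * (3 * x + 3 * x)    ≤⟨ m+k≡n⇒m≤n (51 * x) (solve (x ∷ [])) ⟩
    243 * x                 ∎))
    where open ≤-Reasoning
  ... | inj₂ 3x≤d with m≤n⇒∃[o]m+o≡n 3x≤d
  ...   | e , refl = inj₂ (separated (m+k≡n⇒m≤n e (solve (x ∷ e ∷ [])))
                                     (m+k≡n⇒m≤n (1170 * x + 179 * e) (solve (x ∷ e ∷ []))))

theorem3p2 : NotRegularDorAtMost 1 3 3 × NotRegularDorAtMost 2 2 5 × NotRegularDorAtMost 2 5 3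
    × NotRegularDorAtMost 2 6 3 × NotRegularDorAtMost 3 3 5 × NotRegularDorAtMost 3 4 5
    × NotRegularDorAtMost 3 8 3 × NotRegularDorAtMost 3 9 3
theorem3p2 =
    notRegular 1 3 3 dor13 , notRegular 2 2 5 dor22 , notRegular 2 5 3 dor25
  , notRegular 2 6 3 dor26 , notRegular 3 3 5 dor33 , notRegular 3 4 5 dor34
  , notRegular 3 8 3 dor38 , notRegular 3 9 3 dor39
  where
  notRegular : ∀ a b k → DorAtMost a b k → NotRegularDorAtMost a b k
  notRegular a b k dor = dorAtMost⇒¬regular {a} {b} k dor , dor
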